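{- Let $p,\ell$ be integers with $p\ge 4$ and $3\le \ell\le p$, and let $F$ be a doubly edge-$p$-critical $2$-graph in class $\ell$. Then there is a partition $\mathcal P=V_1\cup\dots\cup V_{p-1}$ of $V(F)$ into $p-1$ parts such that $\mathbf a_F(\mathcal P)=(2,0,\dots,0)$, i.e. $V_1$ contains exactly two edges of $F$ and each $V_i$, $2\le i\le p-1$, contains no edge of $F$.
   Context: $\chi$ denotes the chromatic number. A $2$-graph $F$ is doubly edge-$p$-critical if $\chi(F-e)\ge p$ for every edge $e\in F$ and there exist two edges $e_1,e_2\in F$ with $\chi(F-e_1-e_2)=p-1$. For a partition $\mathcal P=V_1\cup\dots\cup V_{p-1}$ of $V(F)$ into $p-1$ parts, the index vector is $\mathbf a_F(\mathcal P)=(e(V_1),\dots,e(V_{p-1}))$, where $e(V_i)$ is the number of edges of $F$ inside $V_i$. Let $\mathbf{\mathcal P}(F)$ be the set of $(p-1)$-partitions $\mathcal P$ of $V(F)$ with $\|\mathbf a_F(\mathcal P)\|_\infty=1$. For $1\le \ell\le p-1$, $F$ is in class $\ell$ if $\min_{\mathcal P\in\mathbf{\mathcal P}(F)}\|\mathbf a_F(\mathcal P)\|_1=\ell$; if $\mathbf{\mathcal P}(F)=\emptyset$, $F$ is in class $p$. -}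

module Defs where

open import Data.Nat using (ℕ; zero; suc; _+_; _⊔_; _∸_; _≤_; _<_)
open import Data.Fin using (Fin)
import Data.Fin as F
import Data.Fin.Properties as FP
open import Data.Product using (_×_; _,_; Σ; ∃; ∃-syntax)
open import Data.Product.Properties using (≡-dec)
open import Data.Sum using (_⊎_)
open import Data.List using (List; length; filter)
open import Data.List.Relation.Unary.All using (All)
open import Data.List.Relation.Unary.Unique.Propositional using (Unique)
open import Data.List.Membership.Propositional using (_∈_)
open import Relation.Nullary using (¬_; ¬?)
open import Relation.Nullary.Decidable using (_×-dec_)
open import Relation.Binary.PropositionalEquality using (_≡_; _≢_)

-- A finite simple graph ("2-graph") on vertex set Fin n.
-- Each edge {u,v} is stored once, canonically as (u , v) with u < v.
record Graph : Set where
  field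
    n     : ℕ
    edges : List (Fin n × Fin n)
    canon : All (λ e → Data.Product.proj₁ e F.< Data.Product.proj₂ e) edges
    nodup : Unique edges
open Graph public

Edge : Graph → Set
Edge G = Fin (n G) × Fin (n G)

deleteEdge : (G : Graph) → Edge G → List (Edge G) → List (Edge G)
deleteEdge G e = filter (λ x → ¬? (≡-dec FP._≟_ FP._≟_ x e))

Proper : ∀ {m k} → (Fin m → Fin k) → List (Fin m × Fin m) → Set
Proper c es = All (λ e → c (Data.Product.proj₁ e) ≢ c (Data.Product.proj₂ e)) es

ColorableE : (m : ℕ) → List (Fin m × Fin m) → ℕ → Set
ColorableE m es k = Σ (Fin m → Fin k) (λ c → Proper c es)

ChiGeE : (m : ℕ) → List (Fin m × Fin m) → ℕ → Set
ChiGeE m es p = ∀ k → k < p → ¬ ColorableE m es k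

ChiEqE : (m : ℕ) → List (Fin m × Fin m) → ℕ → Set
ChiEqE m es q = ColorableE m es q × ChiGeE m es q

DoublyEdgeCritical : ℕ → Graph → Set
DoublyEdgeCritical p G =
  (∀ e → e ∈ edges G → ChiGeE (n G) (deleteEdge G e (edges G)) p)
  × ∃[ e₁ ] ∃[ e₂ ] (e₁ ∈ edges G × e₂ ∈ edges G × e₁ ≢ e₂ ×
      ChiEqE (n G) (deleteEdge G e₂ (deleteEdge G e₁ (edges G))) (p ∸ 1))

-- a partition of V(G) into k (possibly empty) labelled parts V_0 … V_{k-1}
Partition : Graph → ℕ → Set
Partition G k = Fin (n G) → Fin k

edgesIn : (G : Graph) {k : ℕ} → Partition G k → Fin k → ℕ
edgesIn G P i = length (filter (λ e → (P (Data.Product.proj₁ e) FP.≟ i) ×-dec (P (Data.Product.proj₂ e) FP.≟ i)) (edges G))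

indexVector : (G : Graph) {k : ℕ} → Partition G k → Fin k → ℕ
indexVector G P = edgesIn G P

normInf : ∀ {k} → (Fin k → ℕ) → ℕ
normInf {zero} a = 0
normInf {suc k} a = a F.zero ⊔ normInf (λ i → a (F.suc i))

norm1 : ∀ {k} → (Fin k → ℕ) → ℕ
norm1 {zero} a = 0
norm1 {suc k} a = a F.zero + norm1 (λ i → a (F.suc i))

InCalP : (p : ℕ) (G : Graph) → Partition G (p ∸ 1) → Set
InCalP p G P = normInf (indexVector G P) ≡ 1

InClass : (p : ℕ) → Graph → ℕ → Set
InClass p G ℓ =
  (1 ≤ ℓ × ℓ ≤ p ∸ 1
    × (∃[ P ] (InCalP p G P × norm1 (indexVector G P) ≡ ℓ))
    × (∀ P → InCalP p G P → ℓ ≤ norm1 (indexVector G P)))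
  ⊎ (ℓ ≡ p × (∀ P → ¬ InCalP p G P))

-- A proper (p − 1)-colouring of F − e₁ − e₂ leaves every edge other than e₁, e₂ bichromatic, and
-- both e₁ and e₂ monochromatic, since otherwise F − e₂ or F − e₁ would be (p − 1)-colourable.
-- Read as a partition, its index vector is therefore supported on the colours of e₁ and e₂. If
-- these colours differ, the vector has two entries equal to 1, so the partition lies in 𝒫(F)
-- with ‖a‖₁ = 2 < ℓ, contradicting the class of F. Hence e₁ and e₂ share a colour class, and
-- renaming that class to V₁ gives the index vector (2, 0, …, 0).
module Submission where

open import Defs
open import Data.Empty using (⊥-elim)
open import Data.Fin using (Fin; zero; suc; toℕ; _≟_)
open import Data.Fin.Permutation using (Permutation′; transpose; _⟨$⟩ʳ_)
open import Data.Fin.Properties using (suc-injective)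
open import Data.List using (List; []; _∷_; [_]; filter; length)
open import Data.List.Membership.Propositional using (_∈_)
open import Data.List.Membership.Propositional.Properties using (∈-filter⁺; ∈-filter⁻)
open import Data.List.Membership.Propositional.Properties.WithK using (unique∧set⇒bag)
open import Data.List.Properties using (length-filter; filter-accept; filter-reject; filter-all; filter-none)
open import Data.List.Relation.Binary.BagAndSetEquality using (∼bag⇒↭)
open import Data.List.Relation.Binary.Permutation.Propositional.Properties using (↭-length)
open import Data.List.Relation.Binary.Subset.Propositional using (_⊆_)
open import Data.List.Relation.Unary.All as All using ([]; _∷_)
open import Data.List.Relation.Unary.AllPairs using ([]; _∷_)
open import Data.List.Relation.Unary.Any using (here; there)
open import Data.List.Relation.Unary.Unique.Propositional using (Unique)
open import Data.List.Relation.Unary.Unique.Propositional.Properties using (filter⁺)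
open import Data.Nat using (ℕ; zero; suc; _+_; _≤_; _∸_; z≤n; s≤s)
open import Data.Nat.Properties
  using (+-commutativeSemigroup; ≤-refl; ≤-trans; ≤-antisym; n<1+n; ⊔-lub; m≤m⊔n; m≤n⊔m)
open import Data.Product using (_×_; _,_; ∃-syntax; proj₁; proj₂; uncurry)
open import Data.Product.Properties using (≡-dec)
open import Data.Sum using (_⊎_; inj₁; inj₂; [_,_]′)
import Data.Sum as Sum
open import Function using (_∘_)
open import Function.Bundles using (_⇔_; mk⇔; Equivalence; Injection)
open import Function.Definitions using (Injective)
open import Function.Properties.Inverse using (↔⇒↣)
open import Relation.Binary.PropositionalEquality
  using (module ≡-Reasoning; _≡_; _≢_; refl; sym; trans; cong; cong₂; subst)
open import Relation.Nullary using (¬_; yes; no)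
open import Relation.Nullary.Decidable using (dec-true; decidable-stable; _×-dec_)
open import Relation.Unary using (Decidable)

open import Algebra.Properties.CommutativeSemigroup +-commutativeSemigroup using (interchange)

length-filter-≡ : ∀ {A : Set} {Q : A → Set} (Q? : Decidable Q) {xs ys : List A} →
  Unique xs → Unique ys → (∀ {x} → (x ∈ xs × Q x) ⇔ x ∈ ys) →
  length (filter Q? xs) ≡ length ys
length-filter-≡ Q? xs! ys! same = ↭-length (∼bag⇒↭ (unique∧set⇒bag (filter⁺ Q? xs!) ys! (mk⇔
  (λ x∈ → Equivalence.to same (∈-filter⁻ Q? x∈))
  (λ x∈ → uncurry (∈-filter⁺ Q?) (Equivalence.from same x∈)))))

length-filter-∷ : ∀ {A : Set} {Q : A → Set} (Q? : Decidable Q) x (xs : List A) →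
  length (filter Q? (x ∷ xs)) ≡ length (filter Q? [ x ]) + length (filter Q? xs)
length-filter-∷ Q? x xs with Q? x
... | yes _ = refl
... | no _ = refl

length-filter-pair-≤1 : ∀ {A : Set} {Q : A → Set} (Q? : Decidable Q) {x y} →
  ¬ (Q x × Q y) → length (filter Q? (x ∷ y ∷ [])) ≤ 1
length-filter-pair-≤1 Q? {x} {y} ¬both with Q? x
... | no _ = length-filter Q? [ y ]
... | yes Qx rewrite filter-reject Q? {xs = []} (λ Qy → ¬both (Qx , Qy)) = ≤-refl

norm1-cong : ∀ {k} {a b : Fin k → ℕ} → (∀ i → a i ≡ b i) → norm1 a ≡ norm1 b
norm1-cong {zero} _ = refl
norm1-cong {suc k} a≗b = cong₂ _+_ (a≗b zero) (norm1-cong (a≗b ∘ suc))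

norm1-+ : ∀ {k} (a b : Fin k → ℕ) → norm1 (λ i → a i + b i) ≡ norm1 a + norm1 b
norm1-+ {zero} a b = refl
norm1-+ {suc k} a b =
  trans (cong (a zero + b zero +_) (norm1-+ (a ∘ suc) (b ∘ suc)))
        (interchange (a zero) (b zero) (norm1 (a ∘ suc)) (norm1 (b ∘ suc)))

norm1-zero : ∀ {k} {a : Fin k → ℕ} → (∀ i → a i ≡ 0) → norm1 a ≡ 0
norm1-zero {zero} _ = refl
norm1-zero {suc k} a≡0 = cong₂ _+_ (a≡0 zero) (norm1-zero (a≡0 ∘ suc))

norm1-unit : ∀ {k} {a : Fin k → ℕ} j → a j ≡ 1 → (∀ i → i ≢ j → a i ≡ 0) → norm1 a ≡ 1
norm1-unit zero aj≡1 a≡0 = cong₂ _+_ aj≡1 (norm1-zero (λ i → a≡0 (suc i) λ ()))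
norm1-unit (suc j) aj≡1 a≡0 =
  cong₂ _+_ (a≡0 zero λ ()) (norm1-unit j aj≡1 (λ i i≢j → a≡0 (suc i) (i≢j ∘ suc-injective)))

normInf-lub : ∀ {k} {a : Fin k → ℕ} {b} → (∀ i → a i ≤ b) → normInf a ≤ b
normInf-lub {zero} _ = z≤n
normInf-lub {suc k} a≤b = ⊔-lub (a≤b zero) (normInf-lub (a≤b ∘ suc))

≤-normInf : ∀ {k} (a : Fin k → ℕ) j → a j ≤ normInf a
≤-normInf a zero = m≤m⊔n (a zero) _
≤-normInf a (suc j) = ≤-trans (≤-normInf (a ∘ suc) j) (m≤n⊔m (a zero) _)

InClass⇒≤norm1 : ∀ {p ℓ} G → InClass p G ℓ → ∀ P → InCalP p G P → ℓ ≤ norm1 (indexVector G P)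
InClass⇒≤norm1 _ (inj₁ (_ , _ , _ , minimal)) P P∈𝒫 = minimal P P∈𝒫
InClass⇒≤norm1 _ (inj₂ (_ , 𝒫-empty)) P P∈𝒫 = ⊥-elim (𝒫-empty P P∈𝒫)

Monochromatic : ∀ {m k} → (Fin m → Fin k) → Fin m × Fin m → Set
Monochromatic c e = c (proj₁ e) ≡ c (proj₂ e)

monochromatic? : ∀ {m k} (c : Fin m → Fin k) → Decidable (Monochromatic c)
monochromatic? c e = c (proj₁ e) ≟ c (proj₂ e)

norm1-edgesIn : (G : Graph) {k : ℕ} (P : Partition G k) →
  norm1 (edgesIn G P) ≡ length (filter (monochromatic? P) (edges G))
norm1-edgesIn G {k} P = go (edges G)
  where
  inPart? : (i : Fin k) → Decidable (λ (e : Edge G) → P (proj₁ e) ≡ i × P (proj₂ e) ≡ i)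
  inPart? i e = (P (proj₁ e) ≟ i) ×-dec (P (proj₂ e) ≟ i)

  norm1-singleton : ∀ e →
    norm1 (λ i → length (filter (inPart? i) [ e ])) ≡ length (filter (monochromatic? P) [ e ])
  norm1-singleton e with monochromatic? P e
  ... | yes mono = norm1-unit (P (proj₁ e))
    (cong length (filter-accept (inPart? _) (refl , sym mono)))
    (λ i i≢ → cong length (filter-reject (inPart? i) (λ (in-i , _) → i≢ (sym in-i))))
  ... | no ¬mono = norm1-zero λ i →
    cong length (filter-reject (inPart? i) (λ (in-i , in-i′) → ¬mono (trans in-i (sym in-i′))))

  go : ∀ es → norm1 (λ i → length (filter (inPart? i) es)) ≡ length (filter (monochromatic? P) es)
  go [] = norm1-zero {k} (λ _ → refl)
  go (e ∷ es) = begin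
    norm1 (λ i → length (filter (inPart? i) (e ∷ es)))
      ≡⟨ norm1-cong (λ i → length-filter-∷ (inPart? i) e es) ⟩
    norm1 (λ i → length (filter (inPart? i) [ e ]) + length (filter (inPart? i) es))
      ≡⟨ norm1-+ (λ i → length (filter (inPart? i) [ e ])) (λ i → length (filter (inPart? i) es)) ⟩
    norm1 (λ i → length (filter (inPart? i) [ e ])) + norm1 (λ i → length (filter (inPart? i) es))
      ≡⟨ cong₂ _+_ (norm1-singleton e) (go es) ⟩
    length (filter (monochromatic? P) [ e ]) + length (filter (monochromatic? P) es)
      ≡⟨ sym (length-filter-∷ (monochromatic? P) e es) ⟩
    length (filter (monochromatic? P) (e ∷ es)) ∎
    where open ≡-Reasoning

record DefectiveColouring (G : Graph) (k : ℕ) (ds : List (Edge G)) : Set where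
  field
    colour : Fin (n G) → Fin k
    defects⊆edges : ds ⊆ edges G
    monochromatic⇔defect : ∀ {e} → e ∈ edges G → Monochromatic colour e ⇔ e ∈ ds
open DefectiveColouring

module _ (G : Graph) {k : ℕ} (c : Fin (n G) → Fin k) where

  monochromatic⇒deleted : ∀ {d₁ d₂ e es} → Proper c (deleteEdge G d₂ (deleteEdge G d₁ es)) →
    e ∈ es → Monochromatic c e → e ≡ d₁ ⊎ e ≡ d₂
  monochromatic⇒deleted {d₁} {d₂} {e} proper e∈ mono with ≡-dec _≟_ _≟_ e d₁ | ≡-dec _≟_ _≟_ e d₂
  ... | yes e≡d₁ | _ = inj₁ e≡d₁
  ... | no _ | yes e≡d₂ = inj₂ e≡d₂
  ... | no e≢d₁ | no e≢d₂ =
    ⊥-elim (All.lookup proper (∈-filter⁺ _ (∈-filter⁺ _ e∈ e≢d₁) e≢d₂) mono)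

  -- Otherwise c would be a proper k-colouring of G − d.
  monochromatic-if-critical : ∀ {d d′ es} → ChiGeE (n G) (deleteEdge G d es) (suc k) →
    (∀ {e} → e ∈ es → Monochromatic c e → e ≡ d ⊎ e ≡ d′) → Monochromatic c d′
  monochromatic-if-critical {d} {d′} {es} χ>k onlyDefects =
    decidable-stable (monochromatic? c d′) λ ¬mono → χ>k k (n<1+n k) (c , All.tabulate (proper ¬mono))
    where
    proper : ¬ Monochromatic c d′ → ∀ {e} → e ∈ deleteEdge G d es → ¬ Monochromatic c e
    proper ¬mono e∈ mono with ∈-filter⁻ _ {xs = es} e∈
    ... | e∈es , e≢d with onlyDefects e∈es mono
    ...   | inj₁ e≡d = e≢d e≡d
    ...   | inj₂ refl = ¬mono mono

doublyCritical⇒defectiveColouring : ∀ {m G} → DoublyEdgeCritical (suc m) G →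
  ∃[ e₁ ] ∃[ e₂ ] (e₁ ≢ e₂ × DefectiveColouring G m (e₁ ∷ e₂ ∷ []))
doublyCritical⇒defectiveColouring {m} {G} (critical , e₁ , e₂ , e₁∈ , e₂∈ , e₁≢e₂ , (c , proper) , _) =
  e₁ , e₂ , e₁≢e₂ , record
    { colour = c
    ; defects⊆edges = λ { (here refl) → e₁∈ ; (there (here refl)) → e₂∈ }
    ; monochromatic⇔defect = λ e∈ → mk⇔
        (λ mono → [ here , there ∘ here ]′ (onlyDefects e∈ mono))
        (λ { (here refl) → mono₁ ; (there (here refl)) → mono₂ })
    }
  where
  onlyDefects : ∀ {e} → e ∈ edges G → Monochromatic c e → e ≡ e₁ ⊎ e ≡ e₂
  onlyDefects = monochromatic⇒deleted G c proper
  mono₁ : Monochromatic c e₁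
  mono₁ = monochromatic-if-critical G c (critical e₂ e₂∈) (λ e∈ → Sum.swap ∘ onlyDefects e∈)
  mono₂ : Monochromatic c e₂
  mono₂ = monochromatic-if-critical G c (critical e₁ e₁∈) onlyDefects

recolour : ∀ {G k k′ ds} {g : Fin k → Fin k′} → Injective _≡_ _≡_ g →
  DefectiveColouring G k ds → DefectiveColouring G k′ ds
recolour {g = g} g-injective κ = record
  { colour = g ∘ colour κ
  ; defects⊆edges = defects⊆edges κ
  ; monochromatic⇔defect = λ e∈ → mk⇔
      (Equivalence.to (monochromatic⇔defect κ e∈) ∘ g-injective)
      (cong g ∘ Equivalence.from (monochromatic⇔defect κ e∈))
  }

module _ {G : Graph} {k : ℕ} {ds : List (Edge G)} (ds! : Unique ds) (κ : DefectiveColouring G k ds) where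

  hasColour? : (i : Fin k) → Decidable (λ (e : Edge G) → colour κ (proj₁ e) ≡ i)
  hasColour? i e = colour κ (proj₁ e) ≟ i

  edgesIn-defective : ∀ i → edgesIn G (colour κ) i ≡ length (filter (hasColour? i) ds)
  edgesIn-defective i = length-filter-≡ _ (nodup G) (filter⁺ (hasColour? i) ds!) (mk⇔
    (λ (e∈ , in₁ , in₂) →
      ∈-filter⁺ (hasColour? i) (to (monochromatic⇔defect κ e∈) (trans in₁ (sym in₂))) in₁)
    (λ e∈filter → let e∈ds , in₁ = ∈-filter⁻ (hasColour? i) e∈filter
                      e∈ = defects⊆edges κ e∈ds
                  in e∈ , in₁ , trans (sym (from (monochromatic⇔defect κ e∈) e∈ds)) in₁))
    where open Equivalence

  norm1-defective : norm1 (indexVector G (colour κ)) ≡ length ds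
  norm1-defective = trans (norm1-edgesIn G (colour κ)) (length-filter-≡ _ (nodup G) ds! (mk⇔
    (λ (e∈ , mono) → to (monochromatic⇔defect κ e∈) mono)
    (λ e∈ds → let e∈ = defects⊆edges κ e∈ds in e∈ , from (monochromatic⇔defect κ e∈) e∈ds)))
    where open Equivalence

module _ {G : Graph} {k : ℕ} {e₁ e₂ : Edge G}
         (e₁≢e₂ : e₁ ≢ e₂) (κ : DefectiveColouring G k (e₁ ∷ e₂ ∷ [])) where

  private
    pair! : Unique (e₁ ∷ e₂ ∷ [])
    pair! = (e₁≢e₂ ∷ []) ∷ [] ∷ []
    c : Fin (n G) → Fin k
    c = colour κ
    a : Fin k → ℕ
    a = indexVector G c

  distinctDefectColours⇒norms : c (proj₁ e₁) ≢ c (proj₁ e₂) → normInf a ≡ 1 × norm1 a ≡ 2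
  distinctDefectColours⇒norms k₁≢k₂ =
    ≤-antisym (normInf-lub a≤1) (≤-trans 1≤a[k₁] (≤-normInf a (c (proj₁ e₁)))) ,
    norm1-defective pair! κ
    where
    a≤1 : ∀ i → a i ≤ 1
    a≤1 i rewrite edgesIn-defective pair! κ i =
      length-filter-pair-≤1 (hasColour? pair! κ i) (λ (k₁≡i , k₂≡i) → k₁≢k₂ (trans k₁≡i (sym k₂≡i)))
    1≤a[k₁] : 1 ≤ a (c (proj₁ e₁))
    1≤a[k₁] = subst (1 ≤_)
      (sym (trans (edgesIn-defective pair! κ _) (cong length (filter-accept (hasColour? pair! κ _) refl))))
      (s≤s z≤n)

  sameDefectColour⇒indexVector : ∀ j → c (proj₁ e₁) ≡ j → c (proj₁ e₂) ≡ j →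
    a j ≡ 2 × (∀ i → i ≢ j → a i ≡ 0)
  sameDefectColour⇒indexVector j k₁≡j k₂≡j =
    trans (edgesIn-defective pair! κ j)
      (cong length (filter-all (hasColour? pair! κ j) (k₁≡j ∷ k₂≡j ∷ []))) ,
    λ i i≢j → trans (edgesIn-defective pair! κ i)
      (cong length (filter-none (hasColour? pair! κ i) (≢i k₁≡j i≢j ∷ ≢i k₂≡j i≢j ∷ [])))
    where
    ≢i : ∀ {x i} → x ≡ j → i ≢ j → x ≢ i
    ≢i x≡j i≢j x≡i = i≢j (trans (sym x≡i) x≡j)

transpose-sends : ∀ {n} (i j : Fin n) → transpose i j ⟨$⟩ʳ i ≡ j
transpose-sends i j rewrite dec-true (i ≟ i) refl = refl

lemma2p1 : (p ℓ : ℕ) → 4 ≤ p → 3 ≤ ℓ → ℓ ≤ p → (G : Graph) →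
    DoublyEdgeCritical p G → InClass p G ℓ →
    ∃[ P ] ((∀ (i : Fin (p ∸ 1)) → toℕ i ≡ 0 → indexVector G P i ≡ 2)
    × (∀ (i : Fin (p ∸ 1)) → toℕ i ≢ 0 → indexVector G P i ≡ 0))
lemma2p1 (suc (suc m)) ℓ (s≤s (s≤s _)) 3≤ℓ _ G critical class
  with doublyCritical⇒defectiveColouring critical
... | e₁ , e₂ , e₁≢e₂ , κ with colour κ (proj₁ e₁) ≟ colour κ (proj₁ e₂)
... | no k₁≢k₂ =
  ⊥-elim (3≰2 (≤-trans 3≤ℓ (subst (ℓ ≤_) (proj₂ norms) (InClass⇒≤norm1 G class (colour κ) (proj₁ norms)))))
  where
  norms : normInf (indexVector G (colour κ)) ≡ 1 × norm1 (indexVector G (colour κ)) ≡ 2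
  norms = distinctDefectColours⇒norms e₁≢e₂ κ k₁≢k₂
  3≰2 : ¬ (3 ≤ 2)
  3≰2 (s≤s (s≤s ()))
... | yes k₁≡k₂ =
  colour κ′ , (λ { zero _ → proj₁ a }) , λ { zero 0≢0 → ⊥-elim (0≢0 refl) ; (suc i) _ → proj₂ a (suc i) λ () }
  where
  k₁ : Fin (suc m)
  k₁ = colour κ (proj₁ e₁)
  π : Permutation′ (suc m)
  π = transpose k₁ zero
  κ′ : DefectiveColouring G (suc m) (e₁ ∷ e₂ ∷ [])
  κ′ = recolour (Injection.injective (↔⇒↣ π)) κ
  a : indexVector G (colour κ′) zero ≡ 2 × (∀ i → i ≢ zero → indexVector G (colour κ′) i ≡ 0)
  a = sameDefectColour⇒indexVector e₁≢e₂ κ′ zero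
        (transpose-sends k₁ zero) (trans (cong (π ⟨$⟩ʳ_) (sym k₁≡k₂)) (transpose-sends k₁ zero))
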